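{- Let $k \geq 2$, $r \in \mathbb{N}$, $B \in \mathbb{N}$, and let $u_0 \in \Sigma_k^{B}$, $u_1, \dots, u_r \in \Sigma_k^{3B}$ and $v_1, \dots, v_r \in \Sigma_k^{B}$ be nondegenerate in the sense that $u_r \neq 0^B$ and there is no $i \in \{1,\dots,r\}$ such that $v_i^3 = u_i = v_{i-1}^3$. Let $A = \{ [u_r v_r^{l_r} u_{r-1} \cdots u_1 v_1^{l_1} u_0]_k : l_1, \dots, l_r \in \mathbb{N}_0 \}$. Then $\operatorname{rank} A = r$.
   Context: $\Sigma_k=\{0,\dots,k-1\}$; $\Sigma_k^*$ is the set of finite words over $\Sigma_k$, $\Sigma_k^B$ those of length $B$; $v^l$ is the $l$-fold concatenation; $[w]_k$ is the integer with base-$k$ expansion $w$. A basic arid set of rank $\leq s$ is a set of the form $\{[u'_s v_s'^{l_s} u'_{s-1}\cdots u'_1 v_1'^{l_1} u'_0]_k : l_1,\dots,l_s\in\mathbb{N}_0\}$ with $u'_0,\dots,u'_s, v'_1,\dots,v'_s\in\Sigma_k^*$; an arid set of rank $\leq s$ is a finite union of basic arid sets of rank $\leq s$. For $A\subset\mathbb{N}_0$, $\operatorname{rank} A$ is the smallest $s$ such that $A$ is contained in an arid set of rank $\leq s$, or $\infty$ if no such $s$ exists. -}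

module Defs where

open import Data.Nat using (ℕ; zero; suc; _+_; _*_; _≤_; _<_)
open import Data.Fin using (Fin; toℕ)
open import Data.List using (List; []; _∷_; _++_; concat; replicate; foldl)
open import Data.List.Relation.Unary.Any using (Any)
open import Data.Product using (Σ; _×_)
open import Relation.Binary.PropositionalEquality using (_≡_)
open import Relation.Nullary using (¬_)

-- Words over Σ_k = {0,…,k-1}, most significant digit first.
Word : ℕ → Set
Word k = List (Fin k)

val : (k : ℕ) → Word k → ℕ
val k w = foldl (λ acc d → acc * k + toℕ d) 0 w

pow : {k : ℕ} → Word k → ℕ → Word k
pow w l = concat (replicate l w)

-- The word u_s v_s^{l_s} u_{s-1} ⋯ u_1 v_1^{l_1} u_0
-- (u indexed from 0, v and l indexed from 1; other indices unused).
aridWord : {k : ℕ} → (s : ℕ) → (u v : ℕ → Word k) → (l : ℕ → ℕ) → Word k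
aridWord zero    u v l = u 0
aridWord (suc s) u v l = u (suc s) ++ (pow (v (suc s)) (l (suc s)) ++ aridWord s u v l)

-- Data (u'_0,…,u'_s, v'_1,…,v'_s) of a basic arid set of rank ≤ s.
record AridData (k : ℕ) : Set where
  constructor mkArid
  field
    us : ℕ → Word k
    vs : ℕ → Word k

InBasicArid : (k s : ℕ) → AridData k → ℕ → Set
InBasicArid k s d n =
  Σ (ℕ → ℕ) λ l → n ≡ val k (aridWord s (AridData.us d) (AridData.vs d) l)

-- n belongs to the arid set of rank ≤ s given as a finite union of basic ones.
InArid : (k s : ℕ) → List (AridData k) → ℕ → Set
InArid k s ds n = Any (λ d → InBasicArid k s d n) ds

ContainedInArid : (k : ℕ) → (ℕ → Set) → ℕ → Set
ContainedInArid k A s = Σ (List (AridData k)) λ ds → ∀ n → A n → InArid k s ds n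

RankEq : (k : ℕ) → (ℕ → Set) → ℕ → Set
RankEq k A r = ContainedInArid k A r × (∀ s → s < r → ¬ ContainedInArid k A s)

aridSet : (k r : ℕ) → (u v : ℕ → Word k) → ℕ → Set
aridSet k r u v n = Σ (ℕ → ℕ) λ l → n ≡ val k (aridWord r u v l)

-- Take the words W(x) = u_r v_r^{4+4x_r} ⋯ u_1 v_1^{4+4x_1} u_0 with x ∈ {0,…,M}^r.
-- They are (M+1)^r distinct elements of A below k^{O(M)}: words of different total
-- exponent differ in length by at least 4B > |u_r|, so the nonzero leading block u_r
-- separates their values; equal-length words of equal value are equal, and
-- nondegeneracy lets one read the exponents off the word, since a shift of v_{i+1}^4
-- against the block u_i v_i would force u_i = v_{i+1}^3 and v_i = v_{i+1}.
-- Conversely, below k^L every element of a basic arid set of rank ≤ s has a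
-- representation with all exponents ≤ L (blocks of leading zeros may be dropped),
-- so an arid set given by m basic pieces has at most m (L+1)^s elements there.
-- For s < r the bound m (O(M)+1)^s is eventually smaller than (M+1)^r.
module Submission where

open import Defs
open import Data.Nat using (ℕ; suc; _*_; _≤_; _<_)
open import Data.Fin using (toℕ)
open import Data.List using (length)
open import Data.List.Relation.Unary.All using (All)
open import Data.Product using (Σ; _×_)
open import Relation.Binary.PropositionalEquality using (_≡_)
open import Relation.Nullary using (¬_)

open import Data.Nat using (zero; _+_; _^_; z≤n; s≤s; z<s; _≟_; NonZero; >-nonZero)
open import Data.Nat.Properties
open import Data.Nat.Tactic.RingSolver using (solve-∀)
open import Data.Fin using (Fin)
import Data.Fin.Properties as Fin
open import Data.List using (List; []; _∷_; _++_; foldl; map; concatMap; downFrom; cartesianProductWith)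
import Data.List.Properties as List
open import Data.List.Relation.Unary.All using ([]; _∷_)
import Data.List.Relation.Unary.All as All
import Data.List.Relation.Unary.All.Properties as AllP
open import Data.List.Relation.Unary.Any using (here; there)
import Data.List.Relation.Unary.Any as Any
import Data.List.Relation.Unary.Any.Properties as AnyP
open import Data.List.Membership.Propositional using (_∈_)
open import Data.List.Membership.Propositional.Properties
open import Data.List.Relation.Binary.Subset.Propositional using (_⊆_)
open import Data.List.Relation.Unary.Unique.Propositional using (Unique)
open import Data.List.Relation.Unary.AllPairs using ([]; _∷_)
import Data.List.Relation.Unary.Unique.Propositional.Properties as Unique
open import Data.Vec using (Vec)
import Data.Vec as Vec
import Data.Vec.Properties as Vec
import Data.Vec.Relation.Unary.All as VAll
open import Data.Product using (_,_; proj₁; proj₂; ∃-syntax; Σ-syntax)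
open import Data.Sum using (inj₁; inj₂)
open import Function using (_∘_)
open import Relation.Binary.PropositionalEquality
  using (_≢_; refl; sym; trans; cong; cong₂; subst; module ≡-Reasoning)
open import Relation.Binary.Definitions using (tri<; tri≈; tri>)
open import Relation.Nullary using (Dec; yes; no; contradiction)

*+-<-mono : ∀ {n a b} x y → x < n → a < b → a * n + x < b * n + y
*+-<-mono {n} {a} {b} x y x<n a<b = begin-strict
  a * n + x  <⟨ +-monoʳ-< (a * n) x<n ⟩
  a * n + n  ≡⟨ +-comm (a * n) n ⟩
  suc a * n  ≤⟨ *-monoˡ-≤ n a<b ⟩
  b * n      ≤⟨ m≤m+n (b * n) y ⟩
  b * n + y  ∎
  where open ≤-Reasoning

*+-injectiveˡ : ∀ {n a b x y} → x < n → y < n → a * n + x ≡ b * n + y → a ≡ b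
*+-injectiveˡ {a = a} {b} {x} {y} x<n y<n eq with <-cmp a b
... | tri< a<b _ _ = contradiction eq (<⇒≢ (*+-<-mono x y x<n a<b))
... | tri≈ _ a≡b _ = a≡b
... | tri> _ _ b<a = contradiction (sym eq) (<⇒≢ (*+-<-mono y x y<n b<a))

^-distribʳ-* : ∀ m n o → (m * n) ^ o ≡ m ^ o * n ^ o
^-distribʳ-* m n zero = refl
^-distribʳ-* m n (suc o) =
  trans (cong (m * n *_) (^-distribʳ-* m n o)) (interchange m n (m ^ o) (n ^ o))
  where
  interchange : ∀ a b c d → a * b * (c * d) ≡ a * c * (b * d)
  interchange = solve-∀

length-++-≤ˡ : ∀ {A : Set} (xs ys : List A) → length xs ≤ length (xs ++ ys)
length-++-≤ˡ xs ys = subst (length xs ≤_) (sym (List.length-++ xs)) (m≤m+n _ _)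

length-++-≤ʳ : ∀ {A : Set} (xs ys : List A) → length ys ≤ length (xs ++ ys)
length-++-≤ʳ xs ys = subst (length ys ≤_) (sym (List.length-++ xs)) (m≤n+m _ _)

++-injective : ∀ {A : Set} (xs ys xs′ ys′ : List A) →
               length xs ≡ length xs′ → xs ++ ys ≡ xs′ ++ ys′ → xs ≡ xs′ × ys ≡ ys′
++-injective [] ys [] ys′ _ eq = refl , eq
++-injective (x ∷ xs) ys (x′ ∷ xs′) ys′ len eq
  with x≡x′ , eq′ ← List.∷-injective eq
  with xs≡xs′ , ys≡ys′ ← ++-injective xs ys xs′ ys′ (suc-injective len) eq′
  = cong₂ _∷_ x≡x′ xs≡xs′ , ys≡ys′

++-≢-self : ∀ {A : Set} (xs ys : List A) → 0 < length ys → xs ≢ ys ++ xs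
++-≢-self xs (y ∷ ys) _ eq = m≢1+n+m (length xs) (trans (cong length eq) (cong suc (List.length-++ ys)))

Unique-length-≤ : ∀ {A : Set} {xs ys : List A} → Unique xs → xs ⊆ ys → length xs ≤ length ys
Unique-length-≤ {xs = []} _ _ = z≤n
Unique-length-≤ {xs = x ∷ xs} (x∉xs ∷ xs!) xs⊆ys
  with ys₁ , ys₂ , refl ← ∈-∃++ (xs⊆ys (here refl)) = begin
    suc (length xs)                ≤⟨ s≤s (Unique-length-≤ xs! xs⊆ys₁ys₂) ⟩
    suc (length (ys₁ ++ ys₂))      ≡⟨ cong suc (List.length-++ ys₁) ⟩
    suc (length ys₁ + length ys₂)  ≡⟨ sym (+-suc (length ys₁) (length ys₂)) ⟩
    length ys₁ + suc (length ys₂)  ≡⟨ sym (List.length-++ ys₁) ⟩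
    length (ys₁ ++ x ∷ ys₂)        ∎
  where
  open ≤-Reasoning
  xs⊆ys₁ys₂ : xs ⊆ ys₁ ++ ys₂
  xs⊆ys₁ys₂ {z} z∈xs with ∈-++⁻ ys₁ (xs⊆ys (there z∈xs))
  ... | inj₁ z∈ys₁         = ∈-++⁺ˡ z∈ys₁
  ... | inj₂ (here z≡x)    = contradiction (sym z≡x) (All.lookup x∉xs z∈xs)
  ... | inj₂ (there z∈ys₂) = ∈-++⁺ʳ ys₁ z∈ys₂

length-cartesianProductWith : ∀ {A B C : Set} (f : A → B → C) (xs : List A) (ys : List B) →
  length (cartesianProductWith f xs ys) ≡ length xs * length ys
length-cartesianProductWith f [] ys = refl
length-cartesianProductWith f (x ∷ xs) ys = trans (List.length-++ (map (f x) ys))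
  (cong₂ _+_ (List.length-map (f x) ys) (length-cartesianProductWith f xs ys))

boundedVecs : (n L : ℕ) → List (Vec ℕ n)
boundedVecs zero L = Vec.[] ∷ []
boundedVecs (suc n) L = cartesianProductWith Vec._∷_ (downFrom (suc L)) (boundedVecs n L)

length-boundedVecs : ∀ n L → length (boundedVecs n L) ≡ suc L ^ n
length-boundedVecs zero L = refl
length-boundedVecs (suc n) L =
  trans (length-cartesianProductWith Vec._∷_ (downFrom (suc L)) (boundedVecs n L))
        (cong₂ _*_ (List.length-downFrom (suc L)) (length-boundedVecs n L))

∈-boundedVecs⁺ : ∀ {n L} {xs : Vec ℕ n} → VAll.All (_≤ L) xs → xs ∈ boundedVecs n L
∈-boundedVecs⁺ VAll.[] = here refl
∈-boundedVecs⁺ (x≤L VAll.∷ xs≤L) =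
  ∈-cartesianProductWith⁺ Vec._∷_ (∈-downFrom⁺ (s≤s x≤L)) (∈-boundedVecs⁺ xs≤L)

∈-boundedVecs⁻ : ∀ n {L} {xs : Vec ℕ n} → xs ∈ boundedVecs n L → VAll.All (_≤ L) xs
∈-boundedVecs⁻ zero {xs = Vec.[]} _ = VAll.[]
∈-boundedVecs⁻ (suc n) xs∈
  with _ , _ , x∈ , xs′∈ , refl ← ∈-cartesianProductWith⁻ Vec._∷_ (downFrom _) (boundedVecs n _) xs∈
  = ≤-pred (∈-downFrom⁻ x∈) VAll.∷ ∈-boundedVecs⁻ n xs′∈

boundedVecs-unique : ∀ n L → Unique (boundedVecs n L)
boundedVecs-unique zero L = [] ∷ []
boundedVecs-unique (suc n) L =
  Unique.cartesianProductWith⁺ Vec._∷_ Vec.∷-injective (Unique.downFrom⁺ (suc L)) (boundedVecs-unique n L)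

sum-≤ : ∀ {n M} {xs : Vec ℕ n} → VAll.All (_≤ M) xs → Vec.sum xs ≤ n * M
sum-≤ VAll.[] = z≤n
sum-≤ (x≤M VAll.∷ xs≤M) = +-mono-≤ x≤M (sum-≤ xs≤M)

pow-[] : ∀ {k} n → pow {k} [] n ≡ []
pow-[] zero = refl
pow-[] (suc n) = pow-[] n

pow-+ : ∀ {k} (v : Word k) m n → pow v (m + n) ≡ pow v m ++ pow v n
pow-+ v zero n = refl
pow-+ v (suc m) n = trans (cong (v ++_) (pow-+ v m n)) (sym (List.++-assoc v (pow v m) (pow v n)))

length-pow : ∀ {k} (v : Word k) n → length (pow v n) ≡ n * length v
length-pow v zero = refl
length-pow v (suc n) = trans (List.length-++ v) (cong (length v +_) (length-pow v n))

≤-length-pow : ∀ {k} (v : Word k) n → 0 < length v → n ≤ length (pow v n)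
≤-length-pow v n 0<|v| =
  subst (n ≤_) (sym (length-pow v n)) (subst (_≤ n * length v) (*-identityʳ n) (*-monoʳ-≤ n 0<|v|))

pow-exponent-≤-length : ∀ {k} (v : Word k) n → ∃[ n′ ] n′ ≤ length (pow v n) × pow v n′ ≡ pow v n
pow-exponent-≤-length [] n = 0 , z≤n , sym (pow-[] n)
pow-exponent-≤-length v@(_ ∷ _) n = n , ≤-length-pow v n (s≤s z≤n) , refl

module Digits (k : ℕ) where

  digitStep : ℕ → Fin k → ℕ
  digitStep acc d = acc * k + toℕ d

  foldl-digitStep : ∀ a (w : Word k) → foldl digitStep a w ≡ a * k ^ length w + val k w
  foldl-digitStep a [] = sym (trans (+-identityʳ (a * 1)) (*-identityʳ a))
  foldl-digitStep a (d ∷ w) = begin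
    foldl digitStep (a * k + toℕ d) w              ≡⟨ foldl-digitStep (a * k + toℕ d) w ⟩
    (a * k + toℕ d) * k ^ length w + val k w       ≡⟨ shift a (toℕ d) k (k ^ length w) (val k w) ⟩
    a * (k * k ^ length w) + (toℕ d * k ^ length w + val k w)
      ≡⟨ cong (a * (k * k ^ length w) +_) (sym (foldl-digitStep (toℕ d) w)) ⟩
    a * (k * k ^ length w) + val k (d ∷ w)         ∎
    where
    open ≡-Reasoning
    shift : ∀ a d m p x → (a * m + d) * p + x ≡ a * (m * p) + (d * p + x)
    shift = solve-∀

  val-∷ : ∀ d (w : Word k) → val k (d ∷ w) ≡ toℕ d * k ^ length w + val k w
  val-∷ d w = foldl-digitStep (toℕ d) w

  val-++ : ∀ (x y : Word k) → val k (x ++ y) ≡ val k x * k ^ length y + val k y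
  val-++ x y = trans (List.foldl-++ digitStep 0 x y) (foldl-digitStep (val k x) y)

  val-< : ∀ (w : Word k) → val k w < k ^ length w
  val-< [] = s≤s z≤n
  val-< (d ∷ w) = begin-strict
    val k (d ∷ w)                   ≡⟨ val-∷ d w ⟩
    toℕ d * k ^ length w + val k w  <⟨ *+-<-mono (val k w) 0 (val-< w) (Fin.toℕ<n d) ⟩
    k * k ^ length w + 0            ≡⟨ +-identityʳ _ ⟩
    k * k ^ length w                ∎
    where open ≤-Reasoning

  val-injective : ∀ (x y : Word k) → length x ≡ length y → val k x ≡ val k y → x ≡ y
  val-injective [] [] _ _ = refl
  val-injective (d ∷ x) (e ∷ y) len eq = cong₂ _∷_ (Fin.toℕ-injective d≡e) (val-injective x y |x|≡|y| x≡y)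
    where
    |x|≡|y| = suc-injective len
    eq′ : toℕ d * k ^ length x + val k x ≡ toℕ e * k ^ length x + val k y
    eq′ = trans (sym (val-∷ d x)) (trans eq (trans (val-∷ e y)
            (cong (λ n → toℕ e * k ^ n + val k y) (sym |x|≡|y|))))
    d≡e : toℕ d ≡ toℕ e
    d≡e = *+-injectiveˡ (val-< x) (subst (λ n → val k y < k ^ n) (sym |x|≡|y|) (val-< y)) eq′
    x≡y : val k x ≡ val k y
    x≡y = +-cancelˡ-≡ (toℕ d * k ^ length x) _ _
            (trans eq′ (cong (λ t → t * k ^ length x + val k y) (sym d≡e)))

  val-++-zero⁺ : ∀ (x y : Word k) → val k x ≡ 0 → val k y ≡ 0 → val k (x ++ y) ≡ 0
  val-++-zero⁺ x y x≡0 y≡0 = trans (val-++ x y) (cong₂ (λ a b → a * k ^ length y + b) x≡0 y≡0)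

  val-++-zeroPrefix : ∀ (x y : Word k) → val k x ≡ 0 → val k (x ++ y) ≡ val k y
  val-++-zeroPrefix x y x≡0 = trans (val-++ x y) (cong (λ a → a * k ^ length y + val k y) x≡0)

  val-pow-zero : ∀ (v : Word k) → val k v ≡ 0 → ∀ n → val k (pow v n) ≡ 0
  val-pow-zero v v≡0 zero = refl
  val-pow-zero v v≡0 (suc n) = val-++-zero⁺ v (pow v n) v≡0 (val-pow-zero v v≡0 n)

  module _ .{{_ : NonZero k}} where

    val-positive : ∀ (w : Word k) → ¬ All (λ d → toℕ d ≡ 0) w → 0 < val k w
    val-positive [] w≢0 = contradiction [] w≢0
    val-positive (d ∷ w) dw≢0 with toℕ d ≟ 0
    ... | yes d≡0 =
      ≤-trans (val-positive w (dw≢0 ∘ (d≡0 ∷_))) (subst (val k w ≤_) (sym (val-∷ d w)) (m≤n+m _ _))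
    ... | no d≢0 = begin
      1                                ≤⟨ *-mono-≤ (n≢0⇒n>0 d≢0) (m^n>0 k (length w)) ⟩
      toℕ d * k ^ length w             ≤⟨ m≤m+n _ _ ⟩
      toℕ d * k ^ length w + val k w   ≡⟨ sym (val-∷ d w) ⟩
      val k (d ∷ w)                    ∎
      where open ≤-Reasoning

    val-++-zero⁻ : ∀ (x y : Word k) → val k (x ++ y) ≡ 0 → val k x ≡ 0 × val k y ≡ 0
    val-++-zero⁻ x y xy≡0 =
      m*n≡0⇒m≡0 (val k x) (k ^ length y) {{m^n≢0 k (length y)}} (m+n≡0⇒m≡0 _ sum≡0) ,
      m+n≡0⇒n≡0 _ sum≡0
      where
      sum≡0 = trans (sym (val-++ x y)) xy≡0

    ^-length≤val-++ : ∀ (p q : Word k) → 0 < val k p → k ^ length q ≤ val k (p ++ q)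
    ^-length≤val-++ p q 0<p = begin
      k ^ length q                             ≤⟨ m≤m*n (k ^ length q) (val k p) {{>-nonZero 0<p}} ⟩
      k ^ length q * val k p                   ≡⟨ *-comm (k ^ length q) (val k p) ⟩
      val k p * k ^ length q                   ≤⟨ m≤m+n _ _ ⟩
      val k p * k ^ length q + val k q         ≡⟨ sym (val-++ p q) ⟩
      val k (p ++ q)                           ∎
      where open ≤-Reasoning

    val<val-++ : ∀ (x p q : Word k) → 0 < val k p → length x ≤ length q → val k x < val k (p ++ q)
    val<val-++ x p q 0<p |x|≤|q| =
      <-≤-trans (val-< x) (≤-trans (^-monoʳ-≤ k |x|≤|q|) (^-length≤val-++ p q 0<p))

    length<-val-++ : ∀ (p q : Word k) L → 0 < val k p → val k (p ++ q) < k ^ L → length q < L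
    length<-val-++ p q L 0<p pq<k^L = ≰⇒> λ L≤|q| →
      <-irrefl refl (<-≤-trans pq<k^L (≤-trans (^-monoʳ-≤ k L≤|q|) (^-length≤val-++ p q 0<p)))

module _ {k : ℕ} (us vs : ℕ → Word k) where

  aridWordᵛ : ∀ {s} → Vec ℕ s → Word k
  aridWordᵛ Vec.[] = us 0
  aridWordᵛ {suc s} (a Vec.∷ as) = us (suc s) ++ (pow (vs (suc s)) a ++ aridWordᵛ as)

exponentVec : (s : ℕ) → (ℕ → ℕ) → Vec ℕ s
exponentVec zero l = Vec.[]
exponentVec (suc s) l = l (suc s) Vec.∷ exponentVec s l

exponentVec-cong : ∀ s {l l′ : ℕ → ℕ} → (∀ j → j ≤ s → l j ≡ l′ j) → exponentVec s l ≡ exponentVec s l′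
exponentVec-cong zero _ = refl
exponentVec-cong (suc s) l≗l′ =
  cong₂ Vec._∷_ (l≗l′ (suc s) ≤-refl) (exponentVec-cong s (λ j j≤s → l≗l′ j (m≤n⇒m≤1+n j≤s)))

exponentFun : ∀ {s} → Vec ℕ s → ℕ → ℕ
exponentFun Vec.[] j = 0
exponentFun {suc s} (a Vec.∷ as) j with j ≟ suc s
... | yes _ = a
... | no _ = exponentFun as j

exponentVec-exponentFun : ∀ {s} (as : Vec ℕ s) → exponentVec s (exponentFun as) ≡ as
exponentVec-exponentFun Vec.[] = refl
exponentVec-exponentFun {suc s} (a Vec.∷ as) =
  cong₂ Vec._∷_ top (trans (exponentVec-cong s below) (exponentVec-exponentFun as))
  where
  top : exponentFun (a Vec.∷ as) (suc s) ≡ a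
  top with suc s ≟ suc s
  ... | yes _ = refl
  ... | no s≢s = contradiction refl s≢s
  below : ∀ j → j ≤ s → exponentFun (a Vec.∷ as) j ≡ exponentFun as j
  below j j≤s with j ≟ suc s
  ... | yes refl = contradiction j≤s (<⇒≱ ≤-refl)
  ... | no _ = refl

aridWord-exponentVec : ∀ {k} s (us vs : ℕ → Word k) l →
  aridWord s us vs l ≡ aridWordᵛ us vs (exponentVec s l)
aridWord-exponentVec zero us vs l = refl
aridWord-exponentVec (suc s) us vs l =
  cong (λ w → us (suc s) ++ (pow (vs (suc s)) (l (suc s)) ++ w)) (aridWord-exponentVec s us vs l)

aridWord-exponentFun : ∀ {k s} (us vs : ℕ → Word k) (as : Vec ℕ s) →
  aridWord s us vs (exponentFun as) ≡ aridWordᵛ us vs as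
aridWord-exponentFun {s = s} us vs as =
  trans (aridWord-exponentVec s us vs (exponentFun as)) (cong (aridWordᵛ us vs) (exponentVec-exponentFun as))

module ExponentReduction {k : ℕ} .{{_ : NonZero k}} (us vs : ℕ → Word k) where
  open Digits k

  exponents-≤-length : ∀ {s} (as : Vec ℕ s) →
    Σ[ bs ∈ Vec ℕ s ] VAll.All (_≤ length (aridWordᵛ us vs as)) bs × aridWordᵛ us vs bs ≡ aridWordᵛ us vs as
  exponents-≤-length Vec.[] = Vec.[] , VAll.[] , refl
  exponents-≤-length {suc s} (a Vec.∷ as)
    with bs , bs≤|R| , R≡ ← exponents-≤-length as
    with a′ , a′≤|P| , P≡ ← pow-exponent-≤-length (vs (suc s)) a =
    a′ Vec.∷ bs ,
    ≤-trans a′≤|P| (≤-trans (length-++-≤ˡ P R) (length-++-≤ʳ u _)) VAll.∷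
      VAll.map (λ b≤ → ≤-trans b≤ (≤-trans (length-++-≤ʳ P R) (length-++-≤ʳ u _))) bs≤|R| ,
    cong (u ++_) (cong₂ _++_ P≡ R≡)
    where
    u = us (suc s)
    P = pow (vs (suc s)) a
    R = aridWordᵛ us vs as

  topExponent-≤ : ∀ (u v R : Word k) a L → val k (u ++ (pow v a ++ R)) < k ^ L →
    0 < val k (u ++ pow v a) → ∃[ a′ ] a′ ≤ L × pow v a′ ≡ pow v a
  topExponent-≤ u [] R a L _ _ = 0 , z≤n , sym (pow-[] a)
  topExponent-≤ u (d ∷ w) R zero L _ _ = 0 , z≤n , refl
  topExponent-≤ u v@(d ∷ w) R (suc a) L W<k^L 0<P with val k (u ++ v) ≟ 0
  ... | yes uv≡0 =
    contradiction (val-++-zero⁺ u (pow v (suc a)) u≡0 (val-pow-zero v v≡0 (suc a))) (n>0⇒n≢0 0<P)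
    where
    u≡0 = proj₁ (val-++-zero⁻ u v uv≡0)
    v≡0 = proj₂ (val-++-zero⁻ u v uv≡0)
  ... | no uv≢0 = suc a , a<L , refl
    where
    regroup : u ++ ((v ++ pow v a) ++ R) ≡ (u ++ v) ++ (pow v a ++ R)
    regroup = trans (cong (u ++_) (List.++-assoc v (pow v a) R)) (sym (List.++-assoc u v _))
    a<L : a < L
    a<L = ≤-<-trans (≤-trans (≤-length-pow v a (s≤s z≤n)) (length-++-≤ˡ (pow v a) R))
            (length<-val-++ (u ++ v) (pow v a ++ R) L (n≢0⇒n>0 uv≢0)
              (subst (λ x → val k x < k ^ L) regroup W<k^L))

  ValueWithExponents≤ : ℕ → ∀ {s} → Vec ℕ s → Set
  ValueWithExponents≤ L {s} as =
    Σ[ bs ∈ Vec ℕ s ] VAll.All (_≤ L) bs × val k (aridWordᵛ us vs bs) ≡ val k (aridWordᵛ us vs as)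

  exponents-≤ : ∀ {s} (as : Vec ℕ s) L → val k (aridWordᵛ us vs as) < k ^ L → ValueWithExponents≤ L as
  exponents-≤ Vec.[] L _ = Vec.[] , VAll.[] , refl
  exponents-≤ {suc s} (a Vec.∷ as) L W<k^L = byLeadingBlock (val k (u ++ pow v a) ≟ 0)
    where
    u = us (suc s)
    v = vs (suc s)
    R = aridWordᵛ us vs as
    regroup : u ++ (pow v a ++ R) ≡ (u ++ pow v a) ++ R
    regroup = sym (List.++-assoc u (pow v a) R)
    W≡R : val k (u ++ pow v a) ≡ 0 → val k (u ++ (pow v a ++ R)) ≡ val k R
    W≡R P≡0 = trans (cong (val k) regroup) (val-++-zeroPrefix (u ++ pow v a) R P≡0)

    byLeadingBlock : Dec (val k (u ++ pow v a) ≡ 0) → ValueWithExponents≤ L (a Vec.∷ as)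
    byLeadingBlock (yes P≡0)
      with bs , bs≤L , R≡ ← exponents-≤ as L (subst (_< k ^ L) (W≡R P≡0) W<k^L) =
      0 Vec.∷ bs , z≤n VAll.∷ bs≤L , (begin
        val k (u ++ aridWordᵛ us vs bs)  ≡⟨ val-++-zeroPrefix u _ (proj₁ (val-++-zero⁻ u (pow v a) P≡0)) ⟩
        val k (aridWordᵛ us vs bs)       ≡⟨ R≡ ⟩
        val k R                          ≡⟨ sym (W≡R P≡0) ⟩
        val k (u ++ (pow v a ++ R))      ∎)
      where open ≡-Reasoning
    byLeadingBlock (no P≢0)
      with bs , bs≤|R| , R≡ ← exponents-≤-length as
      with a′ , a′≤L , pow≡ ← topExponent-≤ u v R a L W<k^L (n≢0⇒n>0 P≢0) =
      a′ Vec.∷ bs , a′≤L VAll.∷ VAll.map (λ b≤ → <⇒≤ (≤-<-trans b≤ |R|<L)) bs≤|R| ,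
      cong (λ t → val k (u ++ t)) (cong₂ _++_ pow≡ R≡)
      where
      |R|<L : length R < L
      |R|<L = length<-val-++ (u ++ pow v a) R L (n≢0⇒n>0 P≢0)
                (subst (λ x → val k x < k ^ L) regroup W<k^L)

module SmallElements {k : ℕ} .{{_ : NonZero k}} (s L : ℕ) where

  smallElements : AridData k → List ℕ
  smallElements (mkArid us vs) = map (λ bs → val k (aridWordᵛ us vs bs)) (boundedVecs s L)

  length-smallElements : ∀ ds → length (concatMap smallElements ds) ≡ length ds * suc L ^ s
  length-smallElements [] = refl
  length-smallElements (mkArid us vs ∷ ds) =
    trans (List.length-++ (smallElements (mkArid us vs)))
      (cong₂ _+_ (trans (List.length-map _ (boundedVecs s L)) (length-boundedVecs s L)) (length-smallElements ds))

  ∈-smallElements : ∀ d n → n < k ^ L → InBasicArid k s d n → n ∈ smallElements d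
  ∈-smallElements (mkArid us vs) n n<k^L (l , n≡)
    with bs , bs≤L , bs≡ ← ExponentReduction.exponents-≤ us vs (exponentVec s l) L
                              (subst (_< k ^ L) (trans n≡ (cong (val k) (aridWord-exponentVec s us vs l))) n<k^L)
    = subst (_∈ _) (trans bs≡ (sym (trans n≡ (cong (val k) (aridWord-exponentVec s us vs l)))))
        (∈-map⁺ _ (∈-boundedVecs⁺ bs≤L))

  aridSet-small-count : ∀ ds {xs : List ℕ} → Unique xs → All (λ n → n < k ^ L × InArid k s ds n) xs →
    length xs ≤ length ds * suc L ^ s
  aridSet-small-count ds xs! small = subst (_ ≤_) (length-smallElements ds) (Unique-length-≤ xs! xs⊆)
    where
    xs⊆ : _ ⊆ concatMap smallElements ds
    xs⊆ n∈xs with n<k^L , n∈ds ← All.lookup small n∈xs =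
      ∈-concat⁺ (AnyP.map⁺ (Any.map (∈-smallElements _ _ n<k^L) n∈ds))

module SpreadFamily {k : ℕ} .{{_ : NonZero k}} (r B : ℕ) (u v : ℕ → Word k)
  (B≥1 : 1 ≤ B)
  (|u₀| : length (u 0) ≡ B)
  (|uᵢ| : ∀ i → 1 ≤ i → i ≤ r → length (u i) ≡ 3 * B)
  (|vᵢ| : ∀ i → 1 ≤ i → i ≤ r → length (v i) ≡ B)
  (nondegenerate : ¬ (Σ ℕ λ i → 1 ≤ i × i < r × u i ≡ pow (v (suc i)) 3 × u i ≡ pow (v i) 3))
  where
  open Digits k

  spread : ∀ {n} → Vec ℕ n → Vec ℕ n
  spread = Vec.map (λ x → 4 + 4 * x)

  spreadWord : ∀ {i} → Vec ℕ i → Word k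
  spreadWord xs = aridWordᵛ u v (spread xs)

  length-spreadWord : ∀ {i} → i ≤ r → (xs : Vec ℕ i) →
    length (spreadWord xs) ≡ B + 7 * B * i + 4 * B * Vec.sum xs
  length-spreadWord _ Vec.[] = trans |u₀| (normalise B)
    where
    normalise : ∀ B → B ≡ B + 7 * B * 0 + 4 * B * 0
    normalise = solve-∀
  length-spreadWord {suc i} i<r (x Vec.∷ xs) = begin
    length (uᵢ ++ (pow vᵢ (4 + 4 * x) ++ spreadWord xs))
      ≡⟨ List.length-++ uᵢ ⟩
    length uᵢ + length (pow vᵢ (4 + 4 * x) ++ spreadWord xs)
      ≡⟨ cong (length uᵢ +_) (List.length-++ (pow vᵢ (4 + 4 * x))) ⟩
    length uᵢ + (length (pow vᵢ (4 + 4 * x)) + length (spreadWord xs))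
      ≡⟨ cong₂ (λ a b → a + (b + length (spreadWord xs))) (|uᵢ| (suc i) (s≤s z≤n) i<r)
           (trans (length-pow vᵢ (4 + 4 * x)) (cong ((4 + 4 * x) *_) (|vᵢ| (suc i) (s≤s z≤n) i<r))) ⟩
    3 * B + ((4 + 4 * x) * B + length (spreadWord xs))
      ≡⟨ cong (λ t → 3 * B + ((4 + 4 * x) * B + t)) (length-spreadWord (<⇒≤ i<r) xs) ⟩
    3 * B + ((4 + 4 * x) * B + (B + 7 * B * i + 4 * B * Vec.sum xs))
      ≡⟨ normalise B i x (Vec.sum xs) ⟩
    B + 7 * B * suc i + 4 * B * (x + Vec.sum xs) ∎
    where
    open ≡-Reasoning
    uᵢ = u (suc i)
    vᵢ = v (suc i)
    normalise : ∀ B i x S →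
      3 * B + ((4 + 4 * x) * B + (B + 7 * B * i + 4 * B * S)) ≡ B + 7 * B * suc i + 4 * B * (x + S)
    normalise = solve-∀

  spreadWord-shift-impossible : ∀ {i} → suc i ≤ r → (xs ys : Vec ℕ i) (d : ℕ) →
    spreadWord xs ≢ pow (v (suc i)) (4 + d) ++ spreadWord ys
  spreadWord-shift-impossible i<r Vec.[] Vec.[] d = ++-≢-self (u 0) (pow (v 1) (4 + d))
    (≤-trans (subst (1 ≤_) (sym (|vᵢ| 1 ≤-refl i<r)) B≥1) (length-++-≤ˡ (v 1) _))
  spreadWord-shift-impossible {suc i} i<r (x Vec.∷ xs) ys d eq =
    nondegenerate (suc i , s≤s z≤n , i<r , uᵢ≡w³ , uᵢ≡vᵢ³)
    where
    uᵢ = u (suc i)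
    vᵢ = v (suc i)
    w = v (suc (suc i))
    X = spreadWord xs
    Y = spreadWord ys
    lhs : uᵢ ++ (pow vᵢ (4 + 4 * x) ++ X) ≡ uᵢ ++ (vᵢ ++ (pow vᵢ (3 + 4 * x) ++ X))
    lhs = cong (uᵢ ++_) (List.++-assoc vᵢ _ X)
    rhs : pow w (4 + d) ++ Y ≡ pow w 3 ++ (w ++ (pow w d ++ Y))
    rhs = trans (cong (_++ Y) (pow-+ w 3 (suc d)))
            (trans (List.++-assoc (pow w 3) _ Y) (cong (pow w 3 ++_) (List.++-assoc w _ Y)))
    |w| : length w ≡ B
    |w| = |vᵢ| (suc (suc i)) (s≤s z≤n) i<r
    |uᵢ|≡|w³| : length uᵢ ≡ length (pow w 3)
    |uᵢ|≡|w³| = trans (|uᵢ| (suc i) (s≤s z≤n) (<⇒≤ i<r)) (sym (trans (length-pow w 3) (cong (3 *_) |w|)))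
    split = ++-injective uᵢ _ (pow w 3) _ |uᵢ|≡|w³| (trans (sym lhs) (trans eq rhs))
    uᵢ≡w³ = proj₁ split
    vᵢ≡w : vᵢ ≡ w
    vᵢ≡w = proj₁ (++-injective vᵢ _ w _ (trans (|vᵢ| (suc i) (s≤s z≤n) (<⇒≤ i<r)) (sym |w|))
                                          (proj₂ split))
    uᵢ≡vᵢ³ = trans uᵢ≡w³ (cong (λ t → pow t 3) (sym vᵢ≡w))

  distinct-top-exponents : ∀ {i x y} → suc i ≤ r → x < y → (xs ys : Vec ℕ i) →
    pow (v (suc i)) (4 + 4 * x) ++ spreadWord xs ≢ pow (v (suc i)) (4 + 4 * y) ++ spreadWord ys
  distinct-top-exponents {i} {x} {y} i<r x<y xs ys eq
    with o , 1+x+o≡y ← m≤n⇒∃[o]m+o≡n x<y =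
    spreadWord-shift-impossible i<r xs ys (4 * o) (List.++-cancelˡ (P x) _ _ (begin
      P x ++ X                                ≡⟨ eq ⟩
      P y ++ Y                                ≡⟨ cong (λ n → pow vᵢ n ++ Y) exponent≡ ⟩
      pow vᵢ ((4 + 4 * x) + (4 + 4 * o)) ++ Y ≡⟨ cong (_++ Y) (pow-+ vᵢ (4 + 4 * x) (4 + 4 * o)) ⟩
      (P x ++ P o) ++ Y                       ≡⟨ List.++-assoc (P x) (P o) Y ⟩
      P x ++ (P o ++ Y)                       ∎))
    where
    open ≡-Reasoning
    vᵢ = v (suc i)
    P : ℕ → Word k
    P n = pow vᵢ (4 + 4 * n)
    X = spreadWord xs
    Y = spreadWord ys
    normalise : ∀ x o → 4 + 4 * (suc x + o) ≡ (4 + 4 * x) + (4 + 4 * o)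
    normalise = solve-∀
    exponent≡ : 4 + 4 * y ≡ (4 + 4 * x) + (4 + 4 * o)
    exponent≡ = trans (cong (λ t → 4 + 4 * t) (sym 1+x+o≡y)) (normalise x o)

  spreadWord-injective : ∀ {i} → i ≤ r → (xs ys : Vec ℕ i) → spreadWord xs ≡ spreadWord ys → xs ≡ ys
  spreadWord-injective _ Vec.[] Vec.[] _ = refl
  spreadWord-injective {suc i} i<r (x Vec.∷ xs) (y Vec.∷ ys) eq with <-cmp x y
  ... | tri< x<y _ _ = contradiction tails (distinct-top-exponents i<r x<y xs ys)
    where tails = List.++-cancelˡ (u (suc i)) _ _ eq
  ... | tri> _ _ y<x = contradiction (sym tails) (distinct-top-exponents i<r y<x ys xs)
    where tails = List.++-cancelˡ (u (suc i)) _ _ eq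
  ... | tri≈ _ refl _ = cong (x Vec.∷_) (spreadWord-injective (<⇒≤ i<r) xs ys
          (List.++-cancelˡ (pow (v (suc i)) (4 + 4 * x)) _ _ (List.++-cancelˡ (u (suc i)) _ _ eq)))

  spreadWord-leading-block : ∀ {i} → 1 ≤ i → (ys : Vec ℕ i) → Σ[ rest ∈ Word k ] spreadWord ys ≡ u i ++ rest
  spreadWord-leading-block (s≤s z≤n) (y Vec.∷ ys) = _ , refl

  module _ (1≤r : 1 ≤ r) (0<uᵣ : 0 < val k (u r)) where

    spreadWord-sum-separates : (xs ys : Vec ℕ r) → Vec.sum xs < Vec.sum ys →
      val k (spreadWord xs) < val k (spreadWord ys)
    spreadWord-sum-separates xs ys Σxs<Σys with rest , ys-word≡ ← spreadWord-leading-block 1≤r ys =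
      subst (val k (spreadWord xs) <_) (cong (val k) (sym ys-word≡))
        (val<val-++ (spreadWord xs) (u r) rest 0<uᵣ |xs-word|≤|rest|)
      where
      c = B + 7 * B * r
      regroup : ∀ B c S → 4 * B + (c + 4 * B * S) ≡ c + 4 * B * suc S
      regroup = solve-∀
      |xs-word|≤|rest| : length (spreadWord xs) ≤ length rest
      |xs-word|≤|rest| = +-cancelˡ-≤ (3 * B) _ _ (begin
        3 * B + length (spreadWord xs)    ≤⟨ +-monoˡ-≤ _ (*-monoˡ-≤ B (n≤1+n 3)) ⟩
        4 * B + length (spreadWord xs)    ≡⟨ cong (4 * B +_) (length-spreadWord ≤-refl xs) ⟩
        4 * B + (c + 4 * B * Vec.sum xs)  ≡⟨ regroup B c (Vec.sum xs) ⟩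
        c + 4 * B * suc (Vec.sum xs)      ≤⟨ +-monoʳ-≤ c (*-monoʳ-≤ (4 * B) Σxs<Σys) ⟩
        c + 4 * B * Vec.sum ys            ≡⟨ sym (length-spreadWord ≤-refl ys) ⟩
        length (spreadWord ys)            ≡⟨ cong length ys-word≡ ⟩
        length (u r ++ rest)              ≡⟨ List.length-++ (u r) ⟩
        length (u r) + length rest        ≡⟨ cong (_+ length rest) (|uᵢ| r 1≤r ≤-refl) ⟩
        3 * B + length rest               ∎)
        where open ≤-Reasoning

    spreadWord-val-injective : (xs ys : Vec ℕ r) → val k (spreadWord xs) ≡ val k (spreadWord ys) → xs ≡ ys
    spreadWord-val-injective xs ys eq with <-cmp (Vec.sum xs) (Vec.sum ys)
    ... | tri< Σxs<Σys _ _ = contradiction eq (<⇒≢ (spreadWord-sum-separates xs ys Σxs<Σys))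
    ... | tri> _ _ Σys<Σxs = contradiction (sym eq) (<⇒≢ (spreadWord-sum-separates ys xs Σys<Σxs))
    ... | tri≈ _ Σxs≡Σys _ =
      spreadWord-injective ≤-refl xs ys (val-injective (spreadWord xs) (spreadWord ys) equal-lengths eq)
      where
      equal-lengths = trans (length-spreadWord ≤-refl xs)
        (trans (cong (λ S → B + 7 * B * r + 4 * B * S) Σxs≡Σys) (sym (length-spreadWord ≤-refl ys)))

    spreadWord∈aridSet : (xs : Vec ℕ r) → aridSet k r u v (val k (spreadWord xs))
    spreadWord∈aridSet xs = exponentFun (spread xs) , cong (val k) (sym (aridWord-exponentFun u v (spread xs)))

    spreadWord-< : ∀ M (xs : Vec ℕ r) → VAll.All (_≤ M) xs →
      val k (spreadWord xs) < k ^ (B + 7 * B * r + 4 * B * (r * M))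
    spreadWord-< M xs xs≤M = <-≤-trans (val-< (spreadWord xs)) (^-monoʳ-≤ k (begin
      length (spreadWord xs)              ≡⟨ length-spreadWord ≤-refl xs ⟩
      B + 7 * B * r + 4 * B * Vec.sum xs  ≤⟨ +-monoʳ-≤ (B + 7 * B * r) (*-monoʳ-≤ (4 * B) (sum-≤ xs≤M)) ⟩
      B + 7 * B * r + 4 * B * (r * M)     ∎))
      where open ≤-Reasoning

    cover⇒count-≤ : ∀ {s} (ds : List (AridData k)) → (∀ n → aridSet k r u v n → InArid k s ds n) →
      ∀ M → suc M ^ r ≤ length ds * suc (B + 7 * B * r + 4 * B * (r * M)) ^ s
    cover⇒count-≤ {s} ds A⊆ds M = begin
      suc M ^ r                            ≡⟨ sym (length-boundedVecs r M) ⟩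
      length (boundedVecs r M)             ≡⟨ sym (List.length-map valW (boundedVecs r M)) ⟩
      length (map valW (boundedVecs r M))  ≤⟨ SmallElements.aridSet-small-count s L ds
                                                (Unique.map⁺ (spreadWord-val-injective _ _) (boundedVecs-unique r M))
                                                (AllP.map⁺ (All.tabulate small)) ⟩
      length ds * suc L ^ s                ∎
      where
      open ≤-Reasoning
      L = B + 7 * B * r + 4 * B * (r * M)
      valW : Vec ℕ r → ℕ
      valW xs = val k (spreadWord xs)
      small : ∀ {xs} → xs ∈ boundedVecs r M → valW xs < k ^ L × InArid k s ds (valW xs)
      small {xs} xs∈ = spreadWord-< M xs (∈-boundedVecs⁻ r xs∈) , A⊆ds _ (spreadWord∈aridSet xs)

linear-exponent-bound : ∀ B r M →
  suc (B + 7 * B * r + 4 * B * (r * M)) ≤ suc (B + 7 * B * r + 4 * B * r) * suc M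
linear-exponent-bound B r M =
  subst (suc (B + 7 * B * r + 4 * B * (r * M)) ≤_) (sym (expand B r M)) (m≤m+n _ _)
  where
  expand : ∀ B r M → suc (B + 7 * B * r + 4 * B * r) * suc M
                     ≡ suc (B + 7 * B * r + 4 * B * (r * M)) + (4 * B * r + M + B * M + 7 * B * r * M)
  expand = solve-∀

-- With M = m C^{r₀}, the bound m (C (M+1))^s ≤ M (M+1)^{r₀} is beaten by (M+1)^{r₀+1}.
polynomial-growth : ∀ m C r₀ {s} L → s ≤ r₀ → suc L ≤ C * suc (m * C ^ r₀) →
  m * suc L ^ s < suc (m * C ^ r₀) ^ suc r₀
polynomial-growth m C r₀ {s} L s≤r₀ 1+L≤C[1+M] = begin-strict
  m * suc L ^ s              ≤⟨ *-monoʳ-≤ m (^-monoˡ-≤ s 1+L≤C[1+M]) ⟩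
  m * (C * suc M) ^ s        ≤⟨ *-monoʳ-≤ m (^-monoʳ-≤ (C * suc M) {{C[1+M]≢0}} s≤r₀) ⟩
  m * (C * suc M) ^ r₀       ≡⟨ cong (m *_) (^-distribʳ-* C (suc M) r₀) ⟩
  m * (C ^ r₀ * suc M ^ r₀)  ≡⟨ sym (*-assoc m _ _) ⟩
  M * suc M ^ r₀             <⟨ +-monoˡ-< (M * suc M ^ r₀) (m^n>0 (suc M) r₀) ⟩
  suc M ^ r₀ + M * suc M ^ r₀ ∎
  where
  open ≤-Reasoning
  M = m * C ^ r₀
  C[1+M]≢0 = >-nonZero (<-≤-trans z<s 1+L≤C[1+M])

lemma2p9 : (k r B : ℕ) → 2 ≤ k → 1 ≤ r → 1 ≤ B →
    (u v : ℕ → Word k) →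
    length (u 0) ≡ B →
    (∀ i → 1 ≤ i → i ≤ r → length (u i) ≡ 3 * B) →
    (∀ i → 1 ≤ i → i ≤ r → length (v i) ≡ B) →
    ¬ All (λ d → toℕ d ≡ 0) (u r) →
    ¬ (Σ ℕ λ i → 1 ≤ i × i < r × u i ≡ pow (v (suc i)) 3 × u i ≡ pow (v i) 3) →
    RankEq k (aridSet k r u v) r
lemma2p9 k r B 2≤k 1≤r@(s≤s {n = r₀} z≤n) B≥1 u v |u₀| |uᵢ| |vᵢ| uᵣ≢0 nondegenerate =
  (mkArid u v ∷ [] , λ _ n∈A → here n∈A) , notContained
  where
  instance
    k≢0 : NonZero k
    k≢0 = >-nonZero (≤-trans (s≤s z≤n) 2≤k)
  open SpreadFamily r B u v B≥1 |u₀| |uᵢ| |vᵢ| nondegenerate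
  C = suc (B + 7 * B * r + 4 * B * r)
  notContained : ∀ s → s < r → ¬ ContainedInArid k (aridSet k r u v) s
  notContained s s<r (ds , A⊆ds) = <⇒≱
    (polynomial-growth (length ds) C r₀ _ (≤-pred s<r) (linear-exponent-bound B r M))
    (cover⇒count-≤ 1≤r (Digits.val-positive k (u r) uᵣ≢0) {s} ds A⊆ds M)
    where
    M = length ds * C ^ r₀
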